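{- A tree-child network with $n$ leaves has $n-1$ reticulation nodes if and only if, for every node $v$, there is exactly one directed path starting at $v$ and ending at a leaf all of whose intermediate nodes are tree nodes.
   Context: A (rooted, binary, leaf-labeled) phylogenetic network with $n$ leaves is a finite connected directed acyclic graph without parallel edges whose vertices are of four kinds: a root of indegree $0$ and outdegree $1$; $n$ leaves of indegree $1$ and outdegree $0$, bijectively labeled by $\{1,\ldots,n\}$; tree nodes of indegree $1$ and outdegree $2$; and reticulation nodes of indegree $2$ and outdegree $1$. It is a tree-child network if every node that is not a leaf has at least one child that is not a reticulation node. -}

module Defs where

open import Data.Nat using (ℕ; zero; suc; _+_; _≡ᵇ_)
open import Data.Bool using (Bool; true; false; _∧_; _∨_; T; not)
open import Data.Fin using (Fin)
open import Data.List using (List; []; _∷_; map; allFin)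
open import Data.Nat.ListAction using (sum)
open import Data.Product using (Σ; ∃; _×_; _,_)
open import Data.Sum using (_⊎_)
open import Relation.Nullary using (¬_)
open import Relation.Binary.PropositionalEquality using (_≡_)
open import Relation.Binary.Construct.Closure.ReflexiveTransitive using (Star)
open import Relation.Binary.Construct.Closure.Symmetric using (SymClosure)
open import Relation.Binary.Construct.Closure.Transitive using (TransClosure)
open import Function.Definitions using (Injective)

boolToℕ : Bool → ℕ
boolToℕ true  = 1
boolToℕ false = 0

countFin : (m : ℕ) → (Fin m → Bool) → ℕ
countFin m p = sum (map (λ i → boolToℕ (p i)) (allFin m))

-- A finite directed graph without parallel edges on vertex set Fin m:
-- the edge relation is given by its (boolean) adjacency matrix.
record Digraph : Set where
  field
    size : ℕ
    adj  : Fin size → Fin size → Bool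

  V : Set
  V = Fin size

  Edge : V → V → Set
  Edge u v = T (adj u v)

  indeg : V → ℕ
  indeg v = countFin size (λ u → adj u v)

  outdeg : V → ℕ
  outdeg u = countFin size (λ v → adj u v)

  hasDeg : ℕ → ℕ → V → Bool
  hasDeg i o v = (indeg v ≡ᵇ i) ∧ (outdeg v ≡ᵇ o)

  isRoot isLeaf isTree isRet : V → Bool
  isRoot = hasDeg 0 1
  isLeaf = hasDeg 1 0
  isTree = hasDeg 1 2
  isRet  = hasDeg 2 1

  Root Leaf TreeNode Ret : V → Set
  Root v     = T (isRoot v)
  Leaf v     = T (isLeaf v)
  TreeNode v = T (isTree v)
  Ret v      = T (isRet v)

  Acyclic : Set
  Acyclic = ∀ v → ¬ TransClosure Edge v v

  Connected : Set
  Connected = ∀ u v → Star (SymClosure Edge) u v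

  numRet : ℕ
  numRet = countFin size isRet

  -- A directed path starting at v and ending at a leaf, all of whose
  -- intermediate nodes (i.e. all nodes other than v and the final leaf)
  -- are tree nodes.  It is recorded by the list of vertices after v.
  -- `LeafTail w ws`: w is a vertex of the path other than the start,
  -- ws the vertices after it.
  data LeafTail : V → List V → Set where
    end  : ∀ {w} → Leaf w → LeafTail w []
    cont : ∀ {w x xs} → TreeNode w → Edge w x → LeafTail x xs → LeafTail w (x ∷ xs)

  data TreePathToLeaf : V → List V → Set where
    trivial : ∀ {v} → Leaf v → TreePathToLeaf v []
    step    : ∀ {v w ws} → Edge v w → LeafTail w ws → TreePathToLeaf v (w ∷ ws)

  UniqueTreePathToLeaf : V → Set
  UniqueTreePathToLeaf v =
    Σ (List V) (λ ws → TreePathToLeaf v ws) ×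
    (∀ ws ws′ → TreePathToLeaf v ws → TreePathToLeaf v ws′ → ws ≡ ws′)

-- A rooted binary phylogenetic network with n leaves labelled by Fin n
-- (standing for {1,…,n}).
record PhyloNetwork (n : ℕ) : Set where
  field
    graph     : Digraph
  open Digraph graph public
  field
    acyclic   : Acyclic
    connected : Connected
    kinds     : ∀ v → Root v ⊎ (Leaf v ⊎ (TreeNode v ⊎ Ret v))
    root      : V
    root-root : Root root
    root-uniq : ∀ v → Root v → v ≡ root
    label     : Fin n → V
    label-inj : Injective _≡_ _≡_ label
    label-leaf : ∀ i → Leaf (label i)
    label-surj : ∀ v → Leaf v → ∃ (λ i → label i ≡ v)

TreeChild : ∀ {n} → PhyloNetwork n → Set
TreeChild N = ∀ v → ¬ Leaf v → ∃ (λ w → Edge v w × ¬ Ret w)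
  where open PhyloNetwork N

-- Write t(u) for the number of children of u that are not reticulations
-- (#nonRetChildren below), and T, R for the numbers of tree nodes and
-- reticulations.
--   * Double counting the edges that end in a non-reticulation gives
--     Σ_u t(u) = #leaves + T = n + T, since leaves and tree nodes have
--     indegree 1 and the root has indegree 0.
--   * The non-leaves are the root, the tree nodes and the reticulations,
--     so there are 1 + T + R of them; tree-childness says t(u) ≥ 1 for
--     each of them, hence 1 + T + R ≤ n + T, i.e. R ≤ n - 1.
--   * So R = n - 1 iff t(u) = [u is not a leaf] for every u, iff every
--     node has at most one non-reticulation child.
--   * A tree path to a leaf is built by repeatedly stepping to a
--     non-reticulation child; by tree-childness and acyclicity such a path
--     always exists, and it is unique iff every node has at most one
--     non-reticulation child.
module Submission where

open import Defs
open import Data.Nat using (ℕ; zero; suc; _+_; _*_; _∸_; _≤_; _<_; _≡ᵇ_; z≤n; s≤s)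
open import Data.Nat.Properties
open import Data.Bool using (Bool; true; false; _∧_; not; T)
open import Data.Bool.Properties using (∧-identityʳ; ∧-zeroʳ; T-∧; T-≡)
open import Data.Fin using (Fin; zero; suc; toℕ)
open import Data.Fin.Properties using (pigeonhole; toℕ<n)
  renaming (_≟_ to _≟ᶠ_; suc-injective to fsuc-injective; 0≢1+n to fzero≢fsuc)
open import Data.List using ([]; _∷_; tabulate)
open import Data.List.Properties using (map-tabulate; ∷-injectiveˡ)
import Data.Nat.ListAction as List
open import Data.Product using (∃; _×_; _,_; proj₁; proj₂)
import Data.Product as Product
open import Data.Sum using (_⊎_; inj₁; inj₂)
open import Data.Empty using (⊥-elim)
open import Data.Unit using (tt)
open import Relation.Nullary using (¬_)
open import Relation.Nullary.Decidable using (⌊_⌋; toWitness; fromWitness)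
open import Relation.Binary.PropositionalEquality
open import Relation.Binary.Construct.Closure.Transitive using (TransClosure; [_]; _∷ʳ_)
open import Function using (_∘_; id)
open import Function.Bundles using (_⇔_; mk⇔; Equivalence)
open import Function.Definitions using (Injective)
open import Function.Related.Propositional using (module EquationalReasoning)
open import Algebra.Properties.Semiring.Sum +-*-semiring
  using (sum; sum-syntax; sum-cong-≗; ∑-distrib-+; ∑-comm)

⟦_⟧ : Bool → ℕ
⟦_⟧ = boolToℕ

⟦⟧≤1 : ∀ b → ⟦ b ⟧ ≤ 1
⟦⟧≤1 true  = s≤s z≤n
⟦⟧≤1 false = z≤n

T⇒⟦⟧≡1 : ∀ {b} → T b → ⟦ b ⟧ ≡ 1
T⇒⟦⟧≡1 {true} _ = refl

¬T⇒⟦⟧≡0 : ∀ {b} → ¬ T b → ⟦ b ⟧ ≡ 0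
¬T⇒⟦⟧≡0 {true}  nt = ⊥-elim (nt tt)
¬T⇒⟦⟧≡0 {false} _  = refl

T-∧-not : ∀ {a b} → T (a ∧ not b) ⇔ (T a × ¬ T b)
T-∧-not {true}  {false} = mk⇔ (λ _ → tt , λ ()) (λ _ → tt)
T-∧-not {true}  {true}  = mk⇔ (λ ()) (λ (_ , nb) → nb tt)
T-∧-not {false}         = mk⇔ (λ ()) (λ (a , _) → a)

∀-⇔ : ∀ {A : Set} {P Q : A → Set} → (∀ x → P x ⇔ Q x) → (∀ x → P x) ⇔ (∀ x → Q x)
∀-⇔ P⇔Q = mk⇔ (λ p x → Equivalence.to (P⇔Q x) (p x)) (λ q x → Equivalence.from (P⇔Q x) (q x))

bound-tight⇔ : ∀ n t r → 1 + t + r ≤ n + t → (r ≡ n ∸ 1) ⇔ (1 + t + r ≡ n + t)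
bound-tight⇔ n t r bound = mk⇔
  (λ r≡n∸1 → trans reorder (cong (_+ t) (trans (cong suc r≡n∸1) (m+[n∸m]≡n 1≤n))))
  (λ tight → cong (_∸ 1) (+-cancelʳ-≡ t (suc r) n (trans (sym reorder) tight)))
  where
  reorder : 1 + t + r ≡ suc r + t
  reorder = cong suc (+-comm t r)
  1≤n : 1 ≤ n
  1≤n = +-cancelʳ-≤ t 1 n (≤-trans (m≤m+n (1 + t) r) bound)

count : (m : ℕ) → (Fin m → Bool) → ℕ
count m p = ∑[ i < m ] ⟦ p i ⟧

countFin≡count : ∀ m p → countFin m p ≡ count m p
countFin≡count m p = trans (cong List.sum (map-tabulate id (⟦_⟧ ∘ p))) (sum-tabulate (⟦_⟧ ∘ p))
  where
  sum-tabulate : ∀ {k} (f : Fin k → ℕ) → List.sum (tabulate f) ≡ sum f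
  sum-tabulate {zero}  f = refl
  sum-tabulate {suc k} f = cong (f zero +_) (sum-tabulate (f ∘ suc))

∑-ones : ∀ k → ∑[ i < k ] 1 ≡ k
∑-ones zero    = refl
∑-ones (suc k) = cong suc (∑-ones k)

sum-mono : ∀ {m} {f g : Fin m → ℕ} → (∀ i → f i ≤ g i) → sum f ≤ sum g
sum-mono {zero}  le = z≤n
sum-mono {suc m} le = +-mono-≤ (le zero) (sum-mono (le ∘ suc))

sum-mono-< : ∀ {m} {f g : Fin m → ℕ} → (∀ j → f j ≤ g j) → ∀ i → f i < g i → sum f < sum g
sum-mono-< le zero    lt = +-mono-<-≤ lt (sum-mono (le ∘ suc))
sum-mono-< le (suc i) lt = +-mono-≤-< (le zero) (sum-mono-< (le ∘ suc) i lt)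

sum-≡⇔pointwise : ∀ {m} {f g : Fin m → ℕ} → (∀ i → f i ≤ g i) →
  (sum f ≡ sum g) ⇔ (∀ i → f i ≡ g i)
sum-≡⇔pointwise le = mk⇔
  (λ eq i → ≤-antisym (le i) (≮⇒≥ (λ lt → <-irrefl eq (sum-mono-< le i lt))))
  sum-cong-≗

count-≥1 : ∀ {m} (p : Fin m → Bool) i → T (p i) → 1 ≤ count m p
count-≥1 p zero    t = ≤-trans (≤-reflexive (sym (T⇒⟦⟧≡1 t))) (m≤m+n _ _)
count-≥1 p (suc i) t = ≤-trans (count-≥1 (p ∘ suc) i t) (m≤n+m _ _)

count-none : ∀ {m} (p : Fin m → Bool) → (∀ i → ¬ T (p i)) → count m p ≡ 0
count-none {zero}  p none = refl
count-none {suc m} p none = cong₂ _+_ (¬T⇒⟦⟧≡0 (none zero)) (count-none (p ∘ suc) (none ∘ suc))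

count-∧ : ∀ {m} (p : Fin m → Bool) b → count m (λ i → p i ∧ b) ≡ ⟦ b ⟧ * count m p
count-∧ p true  = trans (sum-cong-≗ (λ i → cong ⟦_⟧ (∧-identityʳ (p i)))) (sym (+-identityʳ _))
count-∧ p false = count-none _ (λ i → subst T (∧-zeroʳ (p i)))

AtMostOne : ∀ {m} → (Fin m → Bool) → Set
AtMostOne p = ∀ i j → T (p i) → T (p j) → i ≡ j

AtMostOne⇒count≤1 : ∀ {m} (p : Fin m → Bool) → AtMostOne p → count m p ≤ 1
AtMostOne⇒count≤1 {zero}  p uniq = z≤n
AtMostOne⇒count≤1 {suc m} p uniq with p zero in p₀
... | true  = ≤-reflexive (cong suc (count-none (p ∘ suc)
                (λ i t → fzero≢fsuc (uniq zero (suc i) (Equivalence.from T-≡ p₀) t))))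
... | false = AtMostOne⇒count≤1 (p ∘ suc) (λ i j ti tj → fsuc-injective (uniq (suc i) (suc j) ti tj))

count≤1⇒AtMostOne : ∀ {m} (p : Fin m → Bool) → count m p ≤ 1 → AtMostOne p
count≤1⇒AtMostOne {suc m} p le zero    zero    _  _  = refl
count≤1⇒AtMostOne {suc m} p le zero    (suc j) t₀ tj =
  ⊥-elim (1+n≰n (≤-trans (+-mono-≤ (≤-reflexive (sym (T⇒⟦⟧≡1 t₀))) (count-≥1 (p ∘ suc) j tj)) le))
count≤1⇒AtMostOne {suc m} p le (suc i) zero    ti t₀ = sym (count≤1⇒AtMostOne p le zero (suc i) t₀ ti)
count≤1⇒AtMostOne {suc m} p le (suc i) (suc j) ti tj =
  cong suc (count≤1⇒AtMostOne (p ∘ suc) (≤-trans (m≤n+m _ _) le) i j ti tj)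

count≤1⇔AtMostOne : ∀ {m} (p : Fin m → Bool) → (count m p ≤ 1) ⇔ AtMostOne p
count≤1⇔AtMostOne p = mk⇔ (count≤1⇒AtMostOne p) (AtMostOne⇒count≤1 p)

count-unique : ∀ {m} (p : Fin m → Bool) j → T (p j) → (∀ i → T (p i) → i ≡ j) → count m p ≡ 1
count-unique p j pj only = ≤-antisym
  (AtMostOne⇒count≤1 p (λ i i′ ti ti′ → trans (only i ti) (sym (only i′ ti′))))
  (count-≥1 p j pj)

count-image : ∀ {k m} (p : Fin m → Bool) (e : Fin k → Fin m) → Injective _≡_ _≡_ e →
  (∀ i → T (p (e i))) → (∀ j → T (p j) → ∃ λ i → e i ≡ j) → count m p ≡ k
count-image {k} {m} p e inj hit onto = begin
  ∑[ j < m ] ⟦ p j ⟧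
    ≡⟨ sum-cong-≗ fibre ⟩
  ∑[ j < m ] ∑[ i < k ] ⟦ ⌊ e i ≟ᶠ j ⌋ ⟧
    ≡⟨ ∑-comm (λ j i → ⟦ ⌊ e i ≟ᶠ j ⌋ ⟧) ⟩
  ∑[ i < k ] ∑[ j < m ] ⟦ ⌊ e i ≟ᶠ j ⌋ ⟧
    ≡⟨ sum-cong-≗ (λ i → count-unique _ (e i) (fromWitness refl) (λ j t → sym (toWitness t))) ⟩
  ∑[ i < k ] 1
    ≡⟨ ∑-ones k ⟩
  k ∎
  where
  open ≡-Reasoning
  fibre : ∀ j → ⟦ p j ⟧ ≡ count k (λ i → ⌊ e i ≟ᶠ j ⌋)
  fibre j with p j in pj
  ... | true with onto j (Equivalence.from T-≡ pj)
  ...   | i₀ , refl = sym (count-unique _ i₀ (fromWitness refl) (λ i t → inj (toWitness t)))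
  fibre j | false = sym (count-none _ (λ i t → subst T pj (subst (T ∘ p) (toWitness t) (hit i))))

-- for a vertex v of a digraph, isRoot v is definitionally
-- root? (indeg v) (outdeg v), and likewise for the other kinds
root? leaf? tree? ret? : ℕ → ℕ → Bool
root? i o = (i ≡ᵇ 0) ∧ (o ≡ᵇ 1)
leaf? i o = (i ≡ᵇ 1) ∧ (o ≡ᵇ 0)
tree? i o = (i ≡ᵇ 1) ∧ (o ≡ᵇ 2)
ret?  i o = (i ≡ᵇ 2) ∧ (o ≡ᵇ 1)

data VertexKind : ℕ → ℕ → Set where
  rootᵏ : VertexKind 0 1
  leafᵏ : VertexKind 1 0
  treeᵏ : VertexKind 1 2
  retᵏ  : VertexKind 2 1

degrees : ∀ a b {i o} → T ((i ≡ᵇ a) ∧ (o ≡ᵇ b)) → i ≡ a × o ≡ b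
degrees a b {i} {o} t = Product.map (≡ᵇ⇒≡ i a) (≡ᵇ⇒≡ o b) (Equivalence.to T-∧ t)

classify : ∀ {i o} → T (root? i o) ⊎ T (leaf? i o) ⊎ T (tree? i o) ⊎ T (ret? i o) → VertexKind i o
classify {i} {o} (inj₁ t) with degrees 0 1 {i} {o} t
... | refl , refl = rootᵏ
classify {i} {o} (inj₂ (inj₁ t)) with degrees 1 0 {i} {o} t
... | refl , refl = leafᵏ
classify {i} {o} (inj₂ (inj₂ (inj₁ t))) with degrees 1 2 {i} {o} t
... | refl , refl = treeᵏ
classify {i} {o} (inj₂ (inj₂ (inj₂ t))) with degrees 2 1 {i} {o} t
... | refl , refl = retᵏ

nonRet-indeg : ∀ {i o} → VertexKind i o → ⟦ not (ret? i o) ⟧ * i ≡ ⟦ leaf? i o ⟧ + ⟦ tree? i o ⟧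
nonRet-indeg rootᵏ = refl
nonRet-indeg leafᵏ = refl
nonRet-indeg treeᵏ = refl
nonRet-indeg retᵏ  = refl

nonLeaf-split : ∀ {i o} → VertexKind i o →
  ⟦ not (leaf? i o) ⟧ ≡ ⟦ root? i o ⟧ + ⟦ tree? i o ⟧ + ⟦ ret? i o ⟧
nonLeaf-split rootᵏ = refl
nonLeaf-split leafᵏ = refl
nonLeaf-split treeᵏ = refl
nonLeaf-split retᵏ  = refl

leaf-outdeg : ∀ {i o} → VertexKind i o → T (leaf? i o) → o ≡ 0
leaf-outdeg leafᵏ _ = refl

leaf-not-tree : ∀ {i o} → VertexKind i o → T (leaf? i o) → ¬ T (tree? i o)
leaf-not-tree leafᵏ _ ()

leafOrTree-not-ret : ∀ {i o} → VertexKind i o → T (leaf? i o) ⊎ T (tree? i o) → ¬ T (ret? i o)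
leafOrTree-not-ret leafᵏ _ ()
leafOrTree-not-ret treeᵏ _ ()
leafOrTree-not-ret retᵏ (inj₁ ())
leafOrTree-not-ret retᵏ (inj₂ ())

entered-nonRet : ∀ {i o} → VertexKind i o → 1 ≤ i → ¬ T (ret? i o) → T (leaf? i o) ⊎ T (tree? i o)
entered-nonRet leafᵏ _ _  = inj₁ tt
entered-nonRet treeᵏ _ _  = inj₂ tt
entered-nonRet retᵏ  _ nr = ⊥-elim (nr tt)

module DigraphFacts (D : Digraph) where
  open Digraph D

  indeg≡count : ∀ v → indeg v ≡ count size (λ u → adj u v)
  indeg≡count v = countFin≡count size (λ u → adj u v)

  edge⇒indeg≥1 : ∀ {u v} → Edge u v → 1 ≤ indeg v
  edge⇒indeg≥1 {u} {v} e = subst (1 ≤_) (sym (indeg≡count v)) (count-≥1 (λ x → adj x v) u e)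

  edge⇒outdeg≥1 : ∀ {u v} → Edge u v → 1 ≤ outdeg u
  edge⇒outdeg≥1 {u} {v} e = subst (1 ≤_) (sym (countFin≡count size (adj u))) (count-≥1 (adj u) v e)

  children-sum : ∀ (q : V → Bool) →
    ∑[ u < size ] count size (λ v → adj u v ∧ q v) ≡ ∑[ v < size ] (⟦ q v ⟧ * indeg v)
  children-sum q = begin
    ∑[ u < size ] ∑[ v < size ] ⟦ adj u v ∧ q v ⟧
      ≡⟨ ∑-comm (λ u v → ⟦ adj u v ∧ q v ⟧) ⟩
    ∑[ v < size ] ∑[ u < size ] ⟦ adj u v ∧ q v ⟧
      ≡⟨ sum-cong-≗ (λ v → count-∧ (λ u → adj u v) (q v)) ⟩
    ∑[ v < size ] (⟦ q v ⟧ * count size (λ u → adj u v))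
      ≡⟨ sum-cong-≗ (λ v → cong (⟦ q v ⟧ *_) (sym (indeg≡count v))) ⟩
    ∑[ v < size ] (⟦ q v ⟧ * indeg v) ∎
    where open ≡-Reasoning

  Walk : (ℕ → V) → ℕ → Set
  Walk w k = ∀ i → i < k → Edge (w i) (w (suc i))

  _◅_ : V → (ℕ → V) → ℕ → V
  (v ◅ w) zero    = v
  (v ◅ w) (suc i) = w i

  ◅-walk : ∀ {u v w k} → Edge u v → Walk (v ◅ w) k → Walk (u ◅ (v ◅ w)) (suc k)
  ◅-walk e walk zero    _         = e
  ◅-walk e walk (suc i) (s≤s i<k) = walk i i<k

  walk-path : ∀ {w k i j} → Walk w k → i < j → j ≤ k → TransClosure Edge (w i) (w j)
  walk-path {j = suc j} walk (s≤s i≤j) j<k with m≤n⇒m<n∨m≡n i≤j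
  ... | inj₁ i<j  = walk-path walk i<j (<⇒≤ j<k) ∷ʳ walk j j<k
  ... | inj₂ refl = [ walk j j<k ]

  -- by the pigeonhole principle a walk with as many edges as vertices
  -- revisits a vertex, so an acyclic digraph has no such walk
  no-long-walk : Acyclic → ∀ w → ¬ Walk w size
  no-long-walk acyclic w walk with pigeonhole (n<1+n size) (λ (i : Fin (suc size)) → w (toℕ i))
  ... | i , j , i<j , wi≡wj =
    acyclic (w (toℕ i)) (subst (TransClosure Edge (w (toℕ i))) (sym wi≡wj)
      (walk-path walk i<j (≤-pred (toℕ<n j))))

module Counting {n} (N : PhyloNetwork n) where
  open PhyloNetwork N
  open DigraphFacts graph public

  kind : ∀ v → VertexKind (indeg v) (outdeg v)
  kind v = classify (kinds v)

  #leaves : count size isLeaf ≡ n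
  #leaves = count-image isLeaf label label-inj label-leaf label-surj

  #roots : count size isRoot ≡ 1
  #roots = count-image isRoot (λ _ → root) (λ { {zero} {zero} _ → refl }) (λ _ → root-root)
    (λ v r → zero , sym (root-uniq v r))

  #trees #rets : ℕ
  #trees = count size isTree
  #rets  = count size isRet

  nonRetChild? : V → V → Bool
  nonRetChild? u v = adj u v ∧ not (isRet v)

  nonRetChild⇔ : ∀ {u v} → T (nonRetChild? u v) ⇔ (Edge u v × ¬ Ret v)
  nonRetChild⇔ = T-∧-not

  #nonRetChildren : V → ℕ
  #nonRetChildren u = count size (nonRetChild? u)

  nonLeaf : V → ℕ
  nonLeaf u = ⟦ not (isLeaf u) ⟧

  ∑nonRetChildren : ∑[ u < size ] #nonRetChildren u ≡ n + #trees
  ∑nonRetChildren = begin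
    ∑[ u < size ] #nonRetChildren u                   ≡⟨ children-sum (not ∘ isRet) ⟩
    ∑[ v < size ] (⟦ not (isRet v) ⟧ * indeg v)       ≡⟨ sum-cong-≗ (nonRet-indeg ∘ kind) ⟩
    ∑[ v < size ] (⟦ isLeaf v ⟧ + ⟦ isTree v ⟧)       ≡⟨ ∑-distrib-+ (⟦_⟧ ∘ isLeaf) (⟦_⟧ ∘ isTree) ⟩
    count size isLeaf + #trees                        ≡⟨ cong (_+ #trees) #leaves ⟩
    n + #trees                                        ∎
    where open ≡-Reasoning

  ∑nonLeaf : ∑[ u < size ] nonLeaf u ≡ 1 + #trees + #rets
  ∑nonLeaf = begin
    ∑[ u < size ] nonLeaf u
      ≡⟨ sum-cong-≗ (nonLeaf-split ∘ kind) ⟩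
    ∑[ u < size ] (⟦ isRoot u ⟧ + ⟦ isTree u ⟧ + ⟦ isRet u ⟧)
      ≡⟨ ∑-distrib-+ (λ u → ⟦ isRoot u ⟧ + ⟦ isTree u ⟧) (⟦_⟧ ∘ isRet) ⟩
    ∑[ u < size ] (⟦ isRoot u ⟧ + ⟦ isTree u ⟧) + #rets
      ≡⟨ cong (_+ #rets) (∑-distrib-+ (⟦_⟧ ∘ isRoot) (⟦_⟧ ∘ isTree)) ⟩
    count size isRoot + #trees + #rets
      ≡⟨ cong (λ r → r + #trees + #rets) #roots ⟩
    1 + #trees + #rets ∎
    where open ≡-Reasoning

module TreeChildNetwork {n} (N : PhyloNetwork n) (tc : TreeChild N) where
  open PhyloNetwork N
  open Counting N public

  nonLeaf⇒nonRetChild : ∀ u → ¬ Leaf u → 1 ≤ #nonRetChildren u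
  nonLeaf⇒nonRetChild u nl with tc u nl
  ... | w , e , nr = count-≥1 (nonRetChild? u) w (Equivalence.from nonRetChild⇔ (e , nr))

  nonLeaf≤#nonRetChildren : ∀ u → nonLeaf u ≤ #nonRetChildren u
  nonLeaf≤#nonRetChildren u with isLeaf u in l
  ... | true  = z≤n
  ... | false = nonLeaf⇒nonRetChild u (λ t → subst T l t)

  leaf-childless : ∀ {u v} → Leaf u → ¬ Edge u v
  leaf-childless {u} l e = 1+n≰n (subst (1 ≤_) (leaf-outdeg (kind u) l) (edge⇒outdeg≥1 e))

  leaf-#nonRetChildren : ∀ {u} → Leaf u → #nonRetChildren u ≡ 0
  leaf-#nonRetChildren {u} l =
    count-none (nonRetChild? u) (λ v c → leaf-childless l (proj₁ (Equivalence.to nonRetChild⇔ c)))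

  LeafOrTree : V → Set
  LeafOrTree v = Leaf v ⊎ TreeNode v

  -- a non-reticulation child is a leaf or a tree node (it has an incoming
  -- edge, so it is not the root), and leaves and tree nodes are not reticulations
  nonRetChild-kind : ∀ {u w} → Edge u w → ¬ Ret w → LeafOrTree w
  nonRetChild-kind {w = w} e nr = entered-nonRet (kind w) (edge⇒indeg≥1 e) nr

  leafOrTree-nonRet : ∀ {w} → LeafOrTree w → ¬ Ret w
  leafOrTree-nonRet {w} = leafOrTree-not-ret (kind w)

  tail-head : ∀ {w xs} → LeafTail w xs → LeafOrTree w
  tail-head (end l)      = inj₁ l
  tail-head (cont t _ _) = inj₂ t

  -- stepping repeatedly to a non-reticulation child (which exists by
  -- tree-childness), within k steps we reach a leaf or walk k edges
  follow : ∀ k w → LeafOrTree w → ∃ (LeafTail w) ⊎ ∃ (λ ws → Walk (w ◅ ws) k)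
  follow zero    w _        = inj₂ ((λ _ → w) , λ i ())
  follow (suc k) w (inj₁ l) = inj₁ ([] , end l)
  follow (suc k) w (inj₂ t) with tc w (λ l → leaf-not-tree (kind w) l t)
  ... | x , e , nr with follow k x (nonRetChild-kind e nr)
  ...   | inj₁ (xs , tail)  = inj₁ (x ∷ xs , cont t e tail)
  ...   | inj₂ (ws , walk)  = inj₂ (x ◅ ws , ◅-walk e walk)

  -- by acyclicity the second outcome is impossible for k = size
  leafTail-exists : ∀ w → LeafOrTree w → ∃ (LeafTail w)
  leafTail-exists w lt with follow size w lt
  ... | inj₁ tail        = tail
  ... | inj₂ (ws , walk) = ⊥-elim (no-long-walk acyclic (w ◅ ws) walk)

  path-through : ∀ {u w} → T (nonRetChild? u w) → ∃ λ xs → TreePathToLeaf u (w ∷ xs)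
  path-through {w = w} c with Equivalence.to nonRetChild⇔ c
  ... | e , nr = Product.map₂ (step e) (leafTail-exists w (nonRetChild-kind e nr))

  path-exists : ∀ v → ∃ (TreePathToLeaf v)
  path-exists v with isLeaf v in l
  ... | true  = [] , trivial (Equivalence.from T-≡ l)
  ... | false with tc v (λ t → subst T l t)
  ...   | w , e , nr = Product.map (w ∷_) id (path-through (Equivalence.from nonRetChild⇔ (e , nr)))

  module _ (atMostOne : ∀ u → AtMostOne (nonRetChild? u)) where
    same-child : ∀ {u w w′} → Edge u w → LeafOrTree w → Edge u w′ → LeafOrTree w′ → w ≡ w′
    same-child e lt e′ lt′ = atMostOne _ _ _
      (Equivalence.from nonRetChild⇔ (e , leafOrTree-nonRet lt))
      (Equivalence.from nonRetChild⇔ (e′ , leafOrTree-nonRet lt′))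

    leafTail-unique : ∀ {w xs xs′} → LeafTail w xs → LeafTail w xs′ → xs ≡ xs′
    leafTail-unique (end _)      (end _)      = refl
    leafTail-unique {w} (end l)  (cont t _ _) = ⊥-elim (leaf-not-tree (kind w) l t)
    leafTail-unique {w} (cont t _ _) (end l)  = ⊥-elim (leaf-not-tree (kind w) l t)
    leafTail-unique (cont _ e tail) (cont _ e′ tail′)
      with same-child e (tail-head tail) e′ (tail-head tail′)
    ... | refl = cong (_ ∷_) (leafTail-unique tail tail′)

    path-unique : ∀ {v ws ws′} → TreePathToLeaf v ws → TreePathToLeaf v ws′ → ws ≡ ws′
    path-unique (trivial _)   (trivial _)  = refl
    path-unique (trivial l)   (step e _)   = ⊥-elim (leaf-childless l e)
    path-unique (step e _)    (trivial l)  = ⊥-elim (leaf-childless l e)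
    path-unique (step e tail) (step e′ tail′)
      with same-child e (tail-head tail) e′ (tail-head tail′)
    ... | refl = cong (_ ∷_) (leafTail-unique tail tail′)

  -- two non-reticulation children of u start two tree paths from u
  unique-paths⇒atMostOne : (∀ v → UniqueTreePathToLeaf v) → ∀ u → AtMostOne (nonRetChild? u)
  unique-paths⇒atMostOne unique u w w′ c c′ with path-through c | path-through c′
  ... | _ , p | _ , p′ = ∷-injectiveˡ (proj₂ (unique u) _ _ p p′)

  atMostOne⇔uniquePaths : (∀ u → AtMostOne (nonRetChild? u)) ⇔ (∀ v → UniqueTreePathToLeaf v)
  atMostOne⇔uniquePaths = mk⇔
    (λ atMostOne v → path-exists v , λ _ _ → path-unique atMostOne)
    unique-paths⇒atMostOne

  -- Σ nonLeaf ≤ Σ #nonRetChildren reads 1 + T + R ≤ n + T, i.e. R ≤ n - 1;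
  -- R = n - 1 exactly when this bound is tight
  numRet⇔sums : (numRet ≡ n ∸ 1) ⇔ (∑[ u < size ] nonLeaf u ≡ ∑[ u < size ] #nonRetChildren u)
  numRet⇔sums = mk⇔
    (λ eq → trans ∑nonLeaf (trans (to (trans (sym numRet≡#rets) eq)) (sym ∑nonRetChildren)))
    (λ eq → trans numRet≡#rets (from (trans (sym ∑nonLeaf) (trans eq ∑nonRetChildren))))
    where
    numRet≡#rets : numRet ≡ #rets
    numRet≡#rets = countFin≡count size isRet
    bound : 1 + #trees + #rets ≤ n + #trees
    bound = subst₂ _≤_ ∑nonLeaf ∑nonRetChildren (sum-mono nonLeaf≤#nonRetChildren)
    open Equivalence (bound-tight⇔ n #trees #rets bound)

  -- every non-leaf has at least one non-reticulation child and a leaf has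
  -- none, so these counts agree iff each is at most one
  exact⇔atMostOne : (∀ u → nonLeaf u ≡ #nonRetChildren u) ⇔ (∀ u → #nonRetChildren u ≤ 1)
  exact⇔atMostOne = mk⇔ (λ eq u → subst (_≤ 1) (eq u) (⟦⟧≤1 _)) exact
    where
    exact : (∀ u → #nonRetChildren u ≤ 1) → ∀ u → nonLeaf u ≡ #nonRetChildren u
    exact le u with isLeaf u in l
    ... | true  = sym (leaf-#nonRetChildren (Equivalence.from T-≡ l))
    ... | false = ≤-antisym (nonLeaf⇒nonRetChild u (λ t → subst T l t)) (le u)

lemma4 : ∀ (n : ℕ) (N : PhyloNetwork n) → TreeChild N →
    (PhyloNetwork.numRet N ≡ n ∸ 1) ⇔ (∀ v → PhyloNetwork.UniqueTreePathToLeaf N v)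
lemma4 n N tc = begin
  (numRet ≡ n ∸ 1)
    ∼⟨ numRet⇔sums ⟩
  (∑[ u < size ] nonLeaf u ≡ ∑[ u < size ] #nonRetChildren u)
    ∼⟨ sum-≡⇔pointwise nonLeaf≤#nonRetChildren ⟩
  (∀ u → nonLeaf u ≡ #nonRetChildren u)
    ∼⟨ exact⇔atMostOne ⟩
  (∀ u → #nonRetChildren u ≤ 1)
    ∼⟨ ∀-⇔ (count≤1⇔AtMostOne ∘ nonRetChild?) ⟩
  (∀ u → AtMostOne (nonRetChild? u))
    ∼⟨ atMostOne⇔uniquePaths ⟩
  (∀ v → UniqueTreePathToLeaf v) ∎
  where
  open PhyloNetwork N
  open TreeChildNetwork N tc
  open EquationalReasoning
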